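{- Let $T=T_\ell$ be the triangulation on $n=2^\ell+2$ vertices described in the context. The number of upward paths in $T$ starting from $o$ is $O(n^{\log 3})=O(n^{1.585})$.
   Context: Logarithms are base 2. For an integer $\ell\ge 0$, $T_\ell$ is the following triangulation on $n=2^\ell+2$ points. The outer face is a triangle $oab$ where $o$ is the origin, $a$ and $b$ lie one on each of the rays from $o$ in directions $\pi/4$ and $3\pi/4$, and $ab$ is horizontal. There are $\ell$ circles $C_0,\dots,C_{\ell-1}$ centered at $o$ with rapidly decreasing radii, all inside the triangle; on $C_i$ there are $2^i$ points, lying on the rays from $o$ in directions $\frac{\pi}{4}+\frac{2j-1}{4\cdot 2^i}\pi$, $j=1,\dots,2^i$. Edges: $ab$, $oa$, $ob$; $o$ is joined to every other vertex; each vertex on $C_i$ is joined to the two vertices among $\{a,b\}\cup C_0\cup\dots\cup C_{i-1}$ closest to it in angular order around $o$ (one on each side). The radii are chosen recursively so that whenever $v\in C_i$ is joined to $v'$ and $v''$ on larger circles or in $\{a,b\}$, $\angle vv'o<\pi/2^{\ell+1}$ and $\angle vv''o<\pi/2^{\ell+1}$. A path is upward if the $y$-coordinate strictly increases along each of its edges. -}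

module Defs where

open import Data.Nat using (ℕ; zero; suc; _+_; _*_; _∸_; _^_; _<_)
open import Data.Fin using (Fin; toℕ)
open import Data.Product using (_×_)
open import Data.Sum using (_⊎_)
open import Data.Empty using (⊥)
open import Data.Unit using (⊤)
open import Data.List using (List; []; _∷_)
open import Relation.Nullary using (¬_)
open import Relation.Binary.PropositionalEquality using (_≡_; _≢_)

-- Vertices of T_ℓ.  c i j is the (j+1)-th point on circle C_i
-- (paper's index j ∈ {1..2^i} corresponds to our 0-based j).
data V (ℓ : ℕ) : Set where
  o a b : V ℓ
  c     : (i : Fin ℓ) → Fin (2 ^ toℕ i) → V ℓ

-- Direction (angle around o) of each vertex other than o, measured in units of
-- π / (4·2^ℓ):  a at π/4, b at 3π/4, and c i j at
-- π/4 + (2(j+1)-1)π/(4·2^i).  (The value for o is irrelevant and never used.)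
angle : ∀ {ℓ} → V ℓ → ℕ
angle {ℓ} o = 0
angle {ℓ} a = 2 ^ ℓ
angle {ℓ} b = 3 * 2 ^ ℓ
angle {ℓ} (c i j) = 2 ^ ℓ + (2 * toℕ j + 1) * 2 ^ (ℓ ∸ toℕ i)

InPrefix : ∀ {ℓ} → ℕ → V ℓ → Set
InPrefix k o = ⊥
InPrefix k a = ⊤
InPrefix k b = ⊤
InPrefix k (c i j) = toℕ i < k

ClosestBelow : ∀ {ℓ} → ℕ → ℕ → V ℓ → Set
ClosestBelow {ℓ} k θ w =
  InPrefix k w × angle w < θ ×
  ((u : V ℓ) → InPrefix k u → ¬ (angle w < angle u × angle u < θ))

ClosestAbove : ∀ {ℓ} → ℕ → ℕ → V ℓ → Set
ClosestAbove {ℓ} k θ w =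
  InPrefix k w × θ < angle w ×
  ((u : V ℓ) → InPrefix k u → ¬ (θ < angle u × angle u < angle w))

JoinedOut : ∀ {ℓ} → V ℓ → V ℓ → Set
JoinedOut o w = ⊥
JoinedOut a w = ⊥
JoinedOut b w = ⊥
JoinedOut (c i j) w =
  ClosestBelow (toℕ i) (angle (c i j)) w ⊎ ClosestAbove (toℕ i) (angle (c i j)) w

Edge : ∀ {ℓ} → V ℓ → V ℓ → Set
Edge u v =
  (u ≡ a × v ≡ b) ⊎ (u ≡ b × v ≡ a) ⊎
  (u ≡ o × v ≢ o) ⊎ (v ≡ o × u ≢ o) ⊎
  JoinedOut u v ⊎ JoinedOut v u

-- Height rank: the y-coordinate order of the endpoints of every edge of T_ℓ.  Smaller rank = higher: a,b have rank 0 (same height),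
-- vertices of C_i rank i+1, and o (the origin, lowest point) rank ℓ+1.
rank : ∀ {ℓ} → V ℓ → ℕ
rank {ℓ} o = suc ℓ
rank a = 0
rank b = 0
rank (c i j) = suc (toℕ i)

UpEdge : ∀ {ℓ} → V ℓ → V ℓ → Set
UpEdge u v = Edge u v × rank v < rank u

data UpPathFrom {ℓ : ℕ} (v : V ℓ) : List (V ℓ) → Set where
  here : UpPathFrom v (v ∷ [])
  step : ∀ {w ps} → UpEdge v w → UpPathFrom w ps → UpPathFrom v (v ∷ ps)

{-# OPTIONS --safe #-}
module Submission where

-- Measure directions around o on the scale where a is at 0 and b at 2^(ℓ+1). Then c i j is at
-- (2j+1)·2^(ℓ-i), all of {a,b} ∪ C_0 ∪ … ∪ C_{i-1} lies on the multiples of 2^(ℓ-i+1), and so the two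
-- upward neighbours of c i j are the ends of the dyadic gap of which it is the midpoint. The upward
-- paths from a midpoint M are therefore [M] and M followed by a path from either end, and recursing
-- into the two half-gaps lists the paths from every vertex inside a gap. If the ends of a gap carry s
-- paths in total, its halves carry 3s + 2, so a gap of depth k contributes at most 3^k(s+2)/2 paths.
-- The outer gap ab has s = 2, hence o starts O(3^ℓ) upward paths, and ℓ ≤ log n.

open import Defs
open import Data.Nat using (ℕ; zero; suc; _+_; _*_; _^_; _∸_; _≤_; _<_; z≤n; s≤s; z<s; _<?_; NonZero; >-nonZero)
open import Data.Nat.Properties
open import Data.Nat.Divisibility using (_∣_; divides; _∣0; ∣-trans; n∣m*n; 1∣_; *-monoʳ-∣)
open import Data.Nat.Logarithm using (⌊log₂_⌋; ⌊log₂⌋-mono-≤; ⌊log₂[2^n]⌋≡n)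
open import Data.Nat.Tactic.RingSolver using (solve-∀)
open import Algebra.Properties.CommutativeSemigroup *-commutativeSemigroup using (x∙yz≈y∙xz)
open import Data.Fin using (Fin; toℕ; fromℕ<)
open import Data.Fin.Properties using (toℕ-injective; toℕ-fromℕ<; toℕ<n)
open import Data.Product using (Σ; ∃; ∃₂; _×_; _,_; uncurry)
open import Data.Sum using (_⊎_; inj₁; inj₂)
open import Data.Empty using (⊥-elim)
open import Data.Unit using (tt)
open import Data.List using (List; []; _∷_; length; map; _++_)
open import Data.List.Properties using (length-++; length-map)
open import Data.List.Membership.Propositional using (_∈_)
open import Data.List.Membership.Propositional.Properties using (∈-map⁺)
open import Data.List.Relation.Binary.Subset.Propositional using (_⊆_)
open import Data.List.Relation.Binary.Subset.Propositional.Properties using (⊆-trans; xs⊆xs++ys; xs⊆ys++xs)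
open import Data.List.Relation.Unary.Any using (here; there)
open import Relation.Nullary using (¬_; yes; no)
open import Relation.Binary.PropositionalEquality
open import Relation.Binary.Definitions using (tri<; tri≈; tri>)

odd≢even : ∀ x y → 2 * x + 1 ≢ 2 * y
odd≢even x y eq = even≢odd y x (trans (sym eq) (+-comm (2 * x) 1))

odd*2^n-injective : ∀ {x y} p q → (2 * x + 1) * 2 ^ p ≡ (2 * y + 1) * 2 ^ q → p ≡ q × x ≡ y
odd*2^n-injective {x} {y} zero zero eq =
  refl , *-cancelˡ-≡ x y 2 (+-cancelʳ-≡ 1 (2 * x) (2 * y) (*-cancelʳ-≡ _ _ 1 eq))
odd*2^n-injective {x} {y} zero (suc q) eq =
  ⊥-elim (odd≢even x ((2 * y + 1) * 2 ^ q)
    (trans (sym (*-identityʳ _)) (trans eq (x∙yz≈y∙xz (2 * y + 1) 2 (2 ^ q)))))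
odd*2^n-injective {x} {y} (suc p) zero eq =
  ⊥-elim (odd≢even y ((2 * x + 1) * 2 ^ p)
    (trans (sym (*-identityʳ _)) (trans (sym eq) (x∙yz≈y∙xz (2 * x + 1) 2 (2 ^ p)))))
odd*2^n-injective {x} {y} (suc p) (suc q) eq
  with odd*2^n-injective p q (*-cancelˡ-≡ _ _ 2 (begin
         2 * ((2 * x + 1) * 2 ^ p)   ≡⟨ x∙yz≈y∙xz 2 (2 * x + 1) (2 ^ p) ⟩
         (2 * x + 1) * 2 ^ suc p     ≡⟨ eq ⟩
         (2 * y + 1) * 2 ^ suc q     ≡⟨ x∙yz≈y∙xz (2 * y + 1) 2 (2 ^ q) ⟩
         2 * ((2 * y + 1) * 2 ^ q)   ∎))
  where open ≡-Reasoning
... | refl , x≡y = refl , x≡y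

^-monoʳ-∣ : ∀ m {n p} → n ≤ p → m ^ n ∣ m ^ p
^-monoʳ-∣ m {p = p} z≤n = 1∣ (m ^ p)
^-monoʳ-∣ m (s≤s n≤p) = *-monoʳ-∣ m (^-monoʳ-∣ m n≤p)

s∣n∧m*s≤n<[1+m]*s⇒n≡m*s : ∀ {s m n} .{{_ : NonZero s}} →
                            s ∣ n → m * s ≤ n → n < suc m * s → n ≡ m * s
s∣n∧m*s≤n<[1+m]*s⇒n≡m*s {s} {m} (divides q refl) lo hi =
  cong (_* s) (≤-antisym (≤-pred (*-cancelʳ-< _ q (suc m) hi)) (*-cancelʳ-≤ m q s lo))

m<n⇒2*m+1<2*n : ∀ {m n} → m < n → 2 * m + 1 < 2 * n
m<n⇒2*m+1<2*n {m} {n} m<n = subst (_≤ 2 * n) (2*[1+m]≡1+[2*m+1] m) (*-monoʳ-≤ 2 m<n)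
  where
  2*[1+m]≡1+[2*m+1] : ∀ m → 2 * suc m ≡ suc (2 * m + 1)
  2*[1+m]≡1+[2*m+1] = solve-∀

m*[2*n]≡[2*m]*n : ∀ m n → m * (2 * n) ≡ 2 * m * n
m*[2*n]≡[2*m]*n = solve-∀

[2*m+1]*n≡m*[2*n]+n : ∀ m n → (2 * m + 1) * n ≡ m * (2 * n) + n
[2*m+1]*n≡m*[2*n]+n = solve-∀

[1+m]*[2*n]≡[2*m+1]*n+n : ∀ m n → suc m * (2 * n) ≡ (2 * m + 1) * n + n
[1+m]*[2*n]≡[2*m+1]*n+n = solve-∀

[1+m]*[2*n]≡[1+[2*m+1]]*n : ∀ m n → suc m * (2 * n) ≡ suc (2 * m + 1) * n
[1+m]*[2*n]≡[1+[2*m+1]]*n = solve-∀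

m+n≡o⇒o∸m≡n : ∀ {m n o} → m + n ≡ o → o ∸ m ≡ n
m+n≡o⇒o∸m≡n {m} {n} refl = m+n∸m≡n m n

module _ {A : Set} where

  cone : A → List (List A) → List (List A)
  cone v P = (v ∷ []) ∷ map (v ∷_) P

  length-cone : ∀ v (P : List (List A)) → length (cone v P) ≡ suc (length P)
  length-cone v P = cong suc (length-map (v ∷_) P)

module Subdivision {A : Set} (mid : ℕ → ℕ → A) where

  -- The paths from the 2^k - 1 midpoints of the subdivision of gap (i, j) to depth k, given the
  -- paths PL, PR from the ends of the gap.
  interior : ℕ → ℕ → ℕ → List (List A) → List (List A) → List (List A)
  interior zero    i j PL PR = []
  interior (suc k) i j PL PR =
    PM ++ interior k (suc i) (2 * j) PL PM ++ interior k (suc i) (2 * j + 1) PM PR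
    where
    PM : List (List A)
    PM = cone (mid i j) (PL ++ PR)

  length-interior : ∀ k i j PL PR →
    2 * length (interior k i j PL PR) + (length PL + length PR) ≤ 3 ^ k * (length PL + length PR + 2)
  length-interior zero    i j PL PR =
    subst (length PL + length PR ≤_) (sym (*-identityˡ _)) (m≤m+n (length PL + length PR) 2)
  length-interior (suc k) i j PL PR = begin
    2 * length (PM ++ IL ++ IR) + (l + r)           ≡⟨ cong (λ n → 2 * n + (l + r)) length-split ⟩
    2 * (m + (x + y)) + (l + r)                     ≡⟨ regroup l r m x y ⟩
    (2 * x + (l + m)) + (2 * y + (m + r))           ≤⟨ +-mono-≤ (length-interior k (suc i) (2 * j) PL PM)
                                                                (length-interior k (suc i) (2 * j + 1) PM PR) ⟩
    3 ^ k * (l + m + 2) + 3 ^ k * (m + r + 2)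
      ≡⟨ cong (λ m → 3 ^ k * (l + m + 2) + 3 ^ k * (m + r + 2)) length-PM ⟩
    3 ^ k * (l + suc (l + r) + 2) + 3 ^ k * (suc (l + r) + r + 2) ≡⟨ collect l r (3 ^ k) ⟩
    3 ^ suc k * (l + r + 2)                         ∎
    where
    open ≤-Reasoning
    PM IL IR : List (List A)
    PM = cone (mid i j) (PL ++ PR)
    IL = interior k (suc i) (2 * j) PL PM
    IR = interior k (suc i) (2 * j + 1) PM PR
    l r m x y : ℕ
    l = length PL
    r = length PR
    m = length PM
    x = length IL
    y = length IR
    regroup : ∀ l r m x y → 2 * (m + (x + y)) + (l + r) ≡ (2 * x + (l + m)) + (2 * y + (m + r))
    regroup = solve-∀
    collect : ∀ l r t → t * (l + suc (l + r) + 2) + t * (suc (l + r) + r + 2) ≡ 3 * t * (l + r + 2)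
    collect = solve-∀
    length-PM : m ≡ suc (l + r)
    length-PM = trans (length-cone (mid i j) (PL ++ PR)) (cong suc (length-++ PL))
    length-split : length (PM ++ IL ++ IR) ≡ m + (x + y)
    length-split = trans (length-++ PM) (cong (m +_) (length-++ IL))

module _ {ℓ : ℕ} where

  -- The value at o is junk: o has no direction.
  position : V ℓ → ℕ
  position o       = 0
  position a       = 0
  position b       = 2 ^ suc ℓ
  position (c i j) = (2 * toℕ j + 1) * 2 ^ (ℓ ∸ toℕ i)

  angle≡2^ℓ+position : ∀ {k} (v : V ℓ) → InPrefix k v → angle v ≡ 2 ^ ℓ + position v
  angle≡2^ℓ+position a       _ = sym (+-identityʳ (2 ^ ℓ))
  angle≡2^ℓ+position b       _ = refl
  angle≡2^ℓ+position (c i j) _ = refl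

  position<⇒angle< : ∀ {k k′} {u v : V ℓ} → InPrefix k u → InPrefix k′ v →
                     position u < position v → angle u < angle v
  position<⇒angle< {u = u} {v} u∈ v∈ lt =
    subst₂ _<_ (sym (angle≡2^ℓ+position u u∈)) (sym (angle≡2^ℓ+position v v∈)) (+-monoʳ-< (2 ^ ℓ) lt)

  angle<⇒position< : ∀ {k k′} {u v : V ℓ} → InPrefix k u → InPrefix k′ v →
                     angle u < angle v → position u < position v
  angle<⇒position< {u = u} {v} u∈ v∈ lt =
    +-cancelˡ-< (2 ^ ℓ) _ _ (subst₂ _<_ (angle≡2^ℓ+position u u∈) (angle≡2^ℓ+position v v∈) lt)

  position-c>0 : ∀ i j → 0 < position (c i j)
  position-c>0 i j = begin-strict
    0                                  <⟨ m^n>0 2 (ℓ ∸ toℕ i) ⟩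
    2 ^ (ℓ ∸ toℕ i)                    ≤⟨ m≤n*m _ (2 * toℕ j + 1) {{>-nonZero (m≤n+m 1 (2 * toℕ j))}} ⟩
    (2 * toℕ j + 1) * 2 ^ (ℓ ∸ toℕ i)  ∎
    where open ≤-Reasoning

  position-c<2^[1+ℓ] : ∀ i j → position (c i j) < 2 ^ suc ℓ
  position-c<2^[1+ℓ] i j = begin-strict
    (2 * toℕ j + 1) * 2 ^ (ℓ ∸ toℕ i)  <⟨ *-monoˡ-< _ {{m^n≢0 2 (ℓ ∸ toℕ i)}} odd<2^[1+i] ⟩
    2 ^ suc (toℕ i) * 2 ^ (ℓ ∸ toℕ i)  ≡⟨ ^-distribˡ-+-* 2 (suc (toℕ i)) (ℓ ∸ toℕ i) ⟨
    2 ^ (suc (toℕ i) + (ℓ ∸ toℕ i))    ≡⟨ cong (λ e → 2 ^ suc e) (m+[n∸m]≡n (<⇒≤ (toℕ<n i))) ⟩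
    2 ^ suc ℓ                          ∎
    where
    open ≤-Reasoning
    odd<2^[1+i] : 2 * toℕ j + 1 < 2 ^ suc (toℕ i)
    odd<2^[1+i] = m<n⇒2*m+1<2*n (toℕ<n j)

  position-c-injective : ∀ {i i′ j j′} → position (c i j) ≡ position (c i′ j′) → c i j ≡ c i′ j′
  position-c-injective {i} {i′} {j} {j′} eq
    with odd*2^n-injective {toℕ j} {toℕ j′} (ℓ ∸ toℕ i) (ℓ ∸ toℕ i′) eq
  ... | ℓ∸i≡ℓ∸i′ , j≡j′
    with toℕ-injective (∸-cancelˡ-≡ (<⇒≤ (toℕ<n i)) (<⇒≤ (toℕ<n i′)) ℓ∸i≡ℓ∸i′)
  ... | refl = cong (c i) (toℕ-injective j≡j′)

  position-injective : ∀ {k k′} (u v : V ℓ) → InPrefix k u → InPrefix k′ v →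
                       position u ≡ position v → u ≡ v
  position-injective a       a         _ _ _  = refl
  position-injective b       b         _ _ _  = refl
  position-injective a       b         _ _ eq = ⊥-elim (<-irrefl eq (m^n>0 2 (suc ℓ)))
  position-injective b       a         _ _ eq = ⊥-elim (<-irrefl (sym eq) (m^n>0 2 (suc ℓ)))
  position-injective a       (c i j)   _ _ eq = ⊥-elim (<-irrefl eq (position-c>0 i j))
  position-injective (c i j) a         _ _ eq = ⊥-elim (<-irrefl (sym eq) (position-c>0 i j))
  position-injective b       (c i j)   _ _ eq = ⊥-elim (<-irrefl (sym eq) (position-c<2^[1+ℓ] i j))
  position-injective (c i j) b         _ _ eq = ⊥-elim (<-irrefl eq (position-c<2^[1+ℓ] i j))
  position-injective (c i j) (c i′ j′) _ _ eq = position-c-injective eq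

  InPrefix-suc : ∀ {k} (v : V ℓ) → InPrefix k v → InPrefix (suc k) v
  InPrefix-suc a       _   = tt
  InPrefix-suc b       _   = tt
  InPrefix-suc (c i j) i<k = m≤n⇒m≤1+n i<k

  InPrefix⇒2^[1+k]∣position : ∀ {i k} (v : V ℓ) → i + k ≡ ℓ → InPrefix i v → 2 ^ suc k ∣ position v
  InPrefix⇒2^[1+k]∣position {k = k} a _ _ = (2 ^ suc k) ∣0
  InPrefix⇒2^[1+k]∣position {i} {k} b refl _ = ^-monoʳ-∣ 2 (s≤s (m≤n+m k i))
  InPrefix⇒2^[1+k]∣position {i} {k} (c i′ j′) refl i′<i =
    ∣-trans (^-monoʳ-∣ 2 (m+n≤o⇒m≤o∸n (suc k) 1+k+i′≤i+k)) (n∣m*n (2 * toℕ j′ + 1))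
    where
    1+k+i′≤i+k : suc k + toℕ i′ ≤ i + k
    1+k+i′≤i+k = subst (_≤ i + k) (cong suc (+-comm (toℕ i′) k)) (+-monoˡ-≤ k i′<i)

  InPrefix⇒rank≤ : ∀ {k} (v : V ℓ) → InPrefix k v → rank v ≤ k
  InPrefix⇒rank≤ a       _   = z≤n
  InPrefix⇒rank≤ b       _   = z≤n
  InPrefix⇒rank≤ (c i j) i<k = i<k

  joinedOut⇒rank< : ∀ (u : V ℓ) {v} → JoinedOut u v → rank v < rank u
  joinedOut⇒rank< (c i j) {v} (inj₁ (v∈ , _)) = s≤s (InPrefix⇒rank≤ v v∈)
  joinedOut⇒rank< (c i j) {v} (inj₂ (v∈ , _)) = s≤s (InPrefix⇒rank≤ v v∈)

  upEdge-c⇒closest : ∀ {i j} {w : V ℓ} → UpEdge (c i j) w →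
    ClosestBelow (toℕ i) (angle (c i j)) w ⊎ ClosestAbove (toℕ i) (angle (c i j)) w
  upEdge-c⇒closest (inj₁ (() , _) , _)
  upEdge-c⇒closest (inj₂ (inj₁ (() , _)) , _)
  upEdge-c⇒closest (inj₂ (inj₂ (inj₁ (() , _))) , _)
  upEdge-c⇒closest {i} (inj₂ (inj₂ (inj₂ (inj₁ (refl , _)))) , o<c) =
    ⊥-elim (<-asym o<c (s≤s (toℕ<n i)))
  upEdge-c⇒closest (inj₂ (inj₂ (inj₂ (inj₂ (inj₁ closest)))) , _) = closest
  upEdge-c⇒closest {w = w} (inj₂ (inj₂ (inj₂ (inj₂ (inj₂ back)))) , w<c) =
    ⊥-elim (<-asym w<c (joinedOut⇒rank< w back))

  closestBelow⇒≡ : ∀ {i k k′} {v x w : V ℓ} → i + k ≡ ℓ → InPrefix i v → InPrefix k′ x →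
    position v < position x → position x < position v + 2 ^ suc k →
    ClosestBelow i (angle x) w → w ≡ v
  closestBelow⇒≡ {k = k} {v = v} {x} {w} depth v∈ x∈ v<x x<v+s (w∈ , w<x , none-between)
    with InPrefix⇒2^[1+k]∣position v depth v∈
  ... | divides m v≡m*s =
    position-injective w v w∈ v∈ (trans w≡m*s (sym v≡m*s))
    where
    m*s≤w : m * 2 ^ suc k ≤ position w
    m*s≤w = subst (_≤ position w) v≡m*s (≮⇒≥ λ w<v →
      none-between v v∈ (position<⇒angle< w∈ v∈ w<v , position<⇒angle< v∈ x∈ v<x))
    w<[1+m]*s : position w < suc m * 2 ^ suc k
    w<[1+m]*s = <-trans (angle<⇒position< w∈ x∈ w<x)
      (subst (position x <_) (trans (cong (_+ 2 ^ suc k) v≡m*s) (+-comm _ (2 ^ suc k))) x<v+s)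
    w≡m*s : position w ≡ m * 2 ^ suc k
    w≡m*s = s∣n∧m*s≤n<[1+m]*s⇒n≡m*s {m = m} {{m^n≢0 2 (suc k)}}
              (InPrefix⇒2^[1+k]∣position w depth w∈) m*s≤w w<[1+m]*s

  closestAbove⇒≡ : ∀ {i k k′} {v x w : V ℓ} → i + k ≡ ℓ → InPrefix i v → InPrefix k′ x →
    position x < position v → position v < position x + 2 ^ suc k →
    ClosestAbove i (angle x) w → w ≡ v
  closestAbove⇒≡ {k = k} {v = v} {x} {w} depth v∈ x∈ x<v v<x+s (w∈ , x<w , none-between)
    with InPrefix⇒2^[1+k]∣position w depth w∈
  ... | divides m w≡m*s =
    position-injective w v w∈ v∈ (trans w≡m*s (sym v≡m*s))
    where
    m*s≤v : m * 2 ^ suc k ≤ position v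
    m*s≤v = subst (_≤ position v) w≡m*s (≮⇒≥ λ v<w →
      none-between v v∈ (position<⇒angle< x∈ v∈ x<v , position<⇒angle< v∈ w∈ v<w))
    v<[1+m]*s : position v < suc m * 2 ^ suc k
    v<[1+m]*s = <-≤-trans v<x+s (subst (position x + 2 ^ suc k ≤_)
      (trans (cong (_+ 2 ^ suc k) w≡m*s) (+-comm _ (2 ^ suc k)))
      (+-monoˡ-≤ (2 ^ suc k) (<⇒≤ (angle<⇒position< x∈ w∈ x<w))))
    v≡m*s : position v ≡ m * 2 ^ suc k
    v≡m*s = s∣n∧m*s≤n<[1+m]*s⇒n≡m*s {m = m} {{m^n≢0 2 (suc k)}}
              (InPrefix⇒2^[1+k]∣position v depth v∈) m*s≤v v<[1+m]*s

  Covers : V ℓ → List (List (V ℓ)) → Set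
  Covers v P = ∀ {ps} → UpPathFrom v ps → ps ∈ P

  covers-⊆ : ∀ {v : V ℓ} {P Q} → P ⊆ Q → Covers v P → Covers v Q
  covers-⊆ P⊆Q covers path = P⊆Q (covers path)

  covers-cone : ∀ {v : V ℓ} {P} → (∀ {w} → UpEdge v w → Covers w P) → Covers v (cone v P)
  covers-cone _  here          = here refl
  covers-cone up (step e path) = there (∈-map⁺ (_ ∷_) (up e path))

  -- Out of range indices give the junk value o.
  vertexAt : ℕ → ℕ → V ℓ
  vertexAt i j with i <? ℓ
  ... | no _ = o
  ... | yes i<ℓ with j <? 2 ^ toℕ (fromℕ< i<ℓ)
  ...   | no _        = o
  ...   | yes j<2^i   = c (fromℕ< i<ℓ) (fromℕ< j<2^i)

  vertexAt-spec : ∀ {i j} → i < ℓ → j < 2 ^ i →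
    ∃₂ λ fi (fj : Fin (2 ^ toℕ fi)) → vertexAt i j ≡ c fi fj × toℕ fi ≡ i × toℕ fj ≡ j
  vertexAt-spec {i} {j} i<ℓ j<2^i with i <? ℓ
  ... | no i≮ℓ = ⊥-elim (i≮ℓ i<ℓ)
  ... | yes i<ℓ′ with j <? 2 ^ toℕ (fromℕ< i<ℓ′)
  ...   | no j≮ = ⊥-elim (j≮ (subst (λ n → j < 2 ^ n) (sym (toℕ-fromℕ< i<ℓ′)) j<2^i))
  ...   | yes j< = fromℕ< i<ℓ′ , fromℕ< j< , refl , toℕ-fromℕ< i<ℓ′ , toℕ-fromℕ< j<

  -- The dyadic gap between positions j·2^(k+1) and (j+1)·2^(k+1); its ends vL, vR are consecutive
  -- in {a,b} ∪ C_0 ∪ … ∪ C_{i-1}, and for k > 0 its midpoint is c i j.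
  record Gap (k i j : ℕ) (vL vR : V ℓ) : Set where
    field
      depth    : i + k ≡ ℓ
      index    : j < 2 ^ i
      left∈    : InPrefix i vL
      right∈   : InPrefix i vR
      left-at  : position vL ≡ j * 2 ^ suc k
      right-at : position vR ≡ suc j * 2 ^ suc k

  Inside : ℕ → ℕ → V ℓ → Set
  Inside k j v = j * 2 ^ suc k < position v × position v < suc j * 2 ^ suc k

  gap-empty : ∀ {k i j} {v : V ℓ} → i + k ≡ ℓ → InPrefix i v → ¬ Inside k j v
  gap-empty {k} {j = j} {v} depth v∈ (lo , hi) =
    <-irrefl (sym (s∣n∧m*s≤n<[1+m]*s⇒n≡m*s {m = j} {{m^n≢0 2 (suc k)}}
                     (InPrefix⇒2^[1+k]∣position v depth v∈) (<⇒≤ lo) hi)) lo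

  module _ {k i j} {vL vR : V ℓ} (g : Gap (suc k) i j vL vR) where
    open Gap g

    private
      t : ℕ
      t = 2 ^ suc k

      t>0 : 0 < t
      t>0 = m^n>0 2 (suc k)

      t<2t : t < 2 * t
      t<2t = m<m+n t (subst (0 <_) (sym (+-identityʳ t)) t>0)

      midpoint : ∃₂ λ fi (fj : Fin (2 ^ toℕ fi)) → vertexAt i j ≡ c fi fj × toℕ fi ≡ i × toℕ fj ≡ j
      midpoint = vertexAt-spec (subst (i <_) depth (m<m+n i z<s)) index

    gap-mid∈ : InPrefix (suc i) (vertexAt i j)
    gap-mid∈ with midpoint
    ... | fi , fj , eq , refl , refl = subst (InPrefix (suc (toℕ fi))) (sym eq) (n<1+n (toℕ fi))

    gap-mid-at : position (vertexAt i j) ≡ (2 * j + 1) * t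
    gap-mid-at with midpoint
    ... | fi , fj , eq , refl , refl =
      trans (cong position eq) (cong (λ e → (2 * toℕ fj + 1) * 2 ^ e) (m+n≡o⇒o∸m≡n depth))

    private
      gap-mid-at′ : position (vertexAt i j) ≡ suc (2 * j) * t
      gap-mid-at′ = trans gap-mid-at (cong (_* t) (+-comm (2 * j) 1))

      mid≡vL+t : position (vertexAt i j) ≡ position vL + t
      mid≡vL+t = trans gap-mid-at (trans ([2*m+1]*n≡m*[2*n]+n j t) (cong (_+ t) (sym left-at)))

      vR≡mid+t : position vR ≡ position (vertexAt i j) + t
      vR≡mid+t = trans right-at (trans ([1+m]*[2*n]≡[2*m+1]*n+n j t) (cong (_+ t) (sym gap-mid-at)))

      half-step : ∀ {x y} → y ≡ x + t → x < y × y < x + 2 * t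
      half-step {x} refl = m<m+n x t>0 , +-monoʳ-< x t<2t

    gap-mid-upEdge : ∀ {w} → UpEdge (vertexAt i j) w → w ≡ vL ⊎ w ≡ vR
    gap-mid-upEdge {w} e with midpoint
    ... | fi , fj , eq , refl , refl with upEdge-c⇒closest (subst (λ x → UpEdge x w) eq e)
    ...   | inj₁ below = inj₁ (uncurry (closestBelow⇒≡ depth left∈ gap-mid∈) (half-step mid≡vL+t)
                                 (subst (λ x → ClosestBelow i (angle x) w) (sym eq) below))
    ...   | inj₂ above = inj₂ (uncurry (closestAbove⇒≡ depth right∈ gap-mid∈) (half-step vR≡mid+t)
                                 (subst (λ x → ClosestAbove i (angle x) w) (sym eq) above))

    gap-left : Gap k (suc i) (2 * j) vL (vertexAt i j)
    gap-left = record
      { depth    = trans (sym (+-suc i k)) depth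
      ; index    = *-monoʳ-< 2 index
      ; left∈    = InPrefix-suc vL left∈
      ; right∈   = gap-mid∈
      ; left-at  = trans left-at (m*[2*n]≡[2*m]*n j t)
      ; right-at = gap-mid-at′
      }

    gap-right : Gap k (suc i) (2 * j + 1) (vertexAt i j) vR
    gap-right = record
      { depth    = trans (sym (+-suc i k)) depth
      ; index    = m<n⇒2*m+1<2*n index
      ; left∈    = gap-mid∈
      ; right∈   = InPrefix-suc vR right∈
      ; left-at  = gap-mid-at
      ; right-at = trans right-at ([1+m]*[2*n]≡[1+[2*m+1]]*n j t)
      }

    inside-split : ∀ {k′} {v : V ℓ} → InPrefix k′ v → Inside (suc k) j v →
      Inside k (2 * j) v ⊎ v ≡ vertexAt i j ⊎ Inside k (2 * j + 1) v
    inside-split {v = v} v∈ (lo , hi) with <-cmp (position v) (position (vertexAt i j))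
    ... | tri< v<mid _ _ = inj₁ (subst (_< position v) (m*[2*n]≡[2*m]*n j t) lo ,
                                 subst (position v <_) gap-mid-at′ v<mid)
    ... | tri≈ _ v≡mid _ = inj₂ (inj₁ (position-injective v _ v∈ gap-mid∈ v≡mid))
    ... | tri> _ _ mid<v = inj₂ (inj₂ (subst (_< position v) gap-mid-at mid<v ,
                                       subst (position v <_) ([1+m]*[2*n]≡[1+[2*m+1]]*n j t) hi))

    gap-mid-covers : ∀ {PL PR} → Covers vL PL → Covers vR PR →
                     Covers (vertexAt i j) (cone (vertexAt i j) (PL ++ PR))
    gap-mid-covers {PL} {PR} covL covR = covers-cone λ e → neighbour (gap-mid-upEdge e)
      where
      neighbour : ∀ {w} → w ≡ vL ⊎ w ≡ vR → Covers w (PL ++ PR)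
      neighbour (inj₁ refl) = covers-⊆ (xs⊆xs++ys PL PR) covL
      neighbour (inj₂ refl) = covers-⊆ (xs⊆ys++xs PR PL) covR

  open Subdivision vertexAt

  interior-covers : ∀ k {i j} {vL vR v : V ℓ} {PL PR} → Gap k i j vL vR → Covers vL PL → Covers vR PR →
    InPrefix ℓ v → Inside k j v → Covers v (interior k i j PL PR)
  interior-covers zero {i} {j} {v = v} g _ _ v∈ inside = ⊥-elim (gap-empty {j = j} depth v∈ᵢ inside)
    where
    open Gap g
    v∈ᵢ : InPrefix i v
    v∈ᵢ = subst (λ n → InPrefix n v) (trans (sym depth) (+-identityʳ i)) v∈
  interior-covers (suc k) {i} {j} {v = v} {PL} {PR} g covL covR v∈ inside = cases (inside-split g v∈ inside)
    where
    PM IL IR : List (List (V ℓ))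
    PM = cone (vertexAt i j) (PL ++ PR)
    IL = interior k (suc i) (2 * j) PL PM
    IR = interior k (suc i) (2 * j + 1) PM PR
    covM : Covers (vertexAt i j) PM
    covM = gap-mid-covers g covL covR

    cases : Inside k (2 * j) v ⊎ v ≡ vertexAt i j ⊎ Inside k (2 * j + 1) v → Covers v (PM ++ IL ++ IR)
    cases (inj₁ insideL)        = covers-⊆ (⊆-trans (xs⊆xs++ys IL IR) (xs⊆ys++xs (IL ++ IR) PM))
                                    (interior-covers k (gap-left g) covL covM v∈ insideL)
    cases (inj₂ (inj₁ refl))    = covers-⊆ (xs⊆xs++ys PM (IL ++ IR)) covM
    cases (inj₂ (inj₂ insideR)) = covers-⊆ (⊆-trans (xs⊆ys++xs IR IL) (xs⊆ys++xs (IL ++ IR) PM))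
                                    (interior-covers k (gap-right g) covM covR v∈ insideR)

  covers-a : Covers a (cone a [])
  covers-a = covers-cone λ { (_ , ()) }

  covers-b : Covers b (cone b [])
  covers-b = covers-cone λ { (_ , ()) }

  outer-gap : Gap ℓ 0 0 a b
  outer-gap = record
    { depth    = refl
    ; index    = z<s
    ; left∈    = tt
    ; right∈   = tt
    ; left-at  = refl
    ; right-at = sym (*-identityˡ (2 ^ suc ℓ))
    }

  c-inside-outer-gap : ∀ i j → Inside ℓ 0 (c i j)
  c-inside-outer-gap i j =
    position-c>0 i j , subst (position (c i j) <_) (sym (*-identityˡ (2 ^ suc ℓ))) (position-c<2^[1+ℓ] i j)

  outer-interior : List (List (V ℓ))
  outer-interior = interior ℓ 0 0 (cone a []) (cone b [])

  upPaths : List (List (V ℓ))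
  upPaths = cone o (cone a [] ++ cone b [] ++ outer-interior)

  covers-upPaths : Covers o upPaths
  covers-upPaths = covers-cone up
    where
    up : ∀ {w} → UpEdge o w → Covers w (cone a [] ++ cone b [] ++ outer-interior)
    up {o}     (_ , o<o) = ⊥-elim (<-irrefl refl o<o)
    up {a}     _         = covers-⊆ (xs⊆xs++ys (cone a []) _) covers-a
    up {b}     _         = covers-⊆ (⊆-trans (xs⊆xs++ys (cone b []) outer-interior) (xs⊆ys++xs _ (cone a [])))
                             covers-b
    up {c i j} _         = covers-⊆ (⊆-trans (xs⊆ys++xs outer-interior (cone b [])) (xs⊆ys++xs _ (cone a [])))
                             (interior-covers ℓ outer-gap covers-a covers-b (toℕ<n i) (c-inside-outer-gap i j))

  length-upPaths : length upPaths ≤ 4 * 3 ^ ℓ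
  length-upPaths = *-cancelˡ-≤ 2 (begin
    2 * length upPaths      ≡⟨ cong (λ n → 2 * (3 + n)) (length-map (o ∷_) outer-interior) ⟩
    2 * (3 + x)             ≡⟨ regroup x ⟩
    4 + (2 * x + 2)         ≤⟨ +-monoʳ-≤ 4 (length-interior ℓ 0 0 (cone a []) (cone b [])) ⟩
    4 + 3 ^ ℓ * 4           ≤⟨ +-monoˡ-≤ (3 ^ ℓ * 4) (m≤m*n 4 (3 ^ ℓ) {{m^n≢0 3 ℓ}}) ⟩
    4 * 3 ^ ℓ + 3 ^ ℓ * 4   ≡⟨ collect (3 ^ ℓ) ⟩
    2 * (4 * 3 ^ ℓ)         ∎)
    where
    open ≤-Reasoning
    x : ℕ
    x = length outer-interior
    regroup : ∀ x → 2 * (3 + x) ≡ 4 + (2 * x + 2)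
    regroup = solve-∀
    collect : ∀ t → 4 * t + t * 4 ≡ 2 * (4 * t)
    collect = solve-∀

ℓ≤⌊log₂[2^ℓ+2]⌋ : ∀ ℓ → ℓ ≤ ⌊log₂ (2 ^ ℓ + 2) ⌋
ℓ≤⌊log₂[2^ℓ+2]⌋ ℓ =
  subst (_≤ ⌊log₂ (2 ^ ℓ + 2) ⌋) (⌊log₂[2^n]⌋≡n ℓ) (⌊log₂⌋-mono-≤ (m≤m+n (2 ^ ℓ) 2))

corollary1 : ∃ λ (K : ℕ) → (ℓ : ℕ) →
    Σ (List (List (V ℓ))) λ L →
      length L ≤ K * 3 ^ ⌊log₂ (2 ^ ℓ + 2) ⌋ ×
      ((ps : List (V ℓ)) → UpPathFrom o ps → ps ∈ L)
corollary1 = 4 , λ ℓ →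
  upPaths ,
  ≤-trans (length-upPaths {ℓ}) (*-monoʳ-≤ 4 (^-monoʳ-≤ 3 (ℓ≤⌊log₂[2^ℓ+2]⌋ ℓ))) ,
  λ _ → covers-upPaths
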